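{- Let $\alpha_1\in\mathcal{NCP}(k_1n),\dots,\alpha_p\in\mathcal{NCP}(k_pn)$. Then $\alpha_1\ast_n\cdots\ast_n\alpha_p$ is noncrossing (i.e. the $p$-tuple is $n$-admissible) if and only if $\alpha_i\ast_n\alpha_j$ is noncrossing for all $1\le i<j\le p$.
   Context: A partition of $[m]=\{1,\dots,m\}$ is noncrossing if there are no two distinct blocks $B,C$ and $a<b<c<d$ with $a,c\in B$, $b,d\in C$; $\mathcal{NCP}(m)$ denotes the set of noncrossing partitions of $[m]$. For $\alpha_1\in\mathcal{NCP}(k_1n),\dots,\alpha_p\in\mathcal{NCP}(k_pn)$, let $K=k_1+\cdots+k_p$. The $n$-perfect shuffle $\alpha_1\ast_n\cdots\ast_n\alpha_p$ is the partition of $[Kn]$ obtained by transporting each $\alpha_i$ along the embedding $[k_in]\to[Kn]$, $ak_i+j\mapsto aK+k_1+\cdots+k_{i-1}+j$ ($0\le a\le n-1$, $1\le j\le k_i$), and taking the union of the resulting blocks. In particular, for $\alpha\in\mathcal{NCP}(kn)$, $\beta\in\mathcal{NCP}(ln)$, $\alpha\ast_n\beta$ is the partition of $[(k+l)n]$ given by the embeddings $ak+j\mapsto a(k+l)+j$ and $al+j\mapsto a(k+l)+k+j$. -}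

module Defs where

open import Data.Nat using (ℕ; zero; suc; _+_; _*_; _<_)
open import Data.Fin using (Fin; zero; suc; toℕ)
import Data.Fin as F
open import Data.Product using (Σ; ∃; ∃-syntax; _×_; _,_)
open import Relation.Binary.PropositionalEquality using (_≡_)

-- A partition of [m] (positions 0-based: Fin m) is given by a block-labelling
-- function: x and y lie in the same block iff they carry the same label.
Partition : ℕ → Set
Partition m = Fin m → ℕ

-- Noncrossing for the block relation R of a partition of [m]:
-- whenever a < b < c < d with a ~ c and b ~ d, the two blocks coincide (a ~ b).
-- (Equivalently: no two distinct blocks B, C and a<b<c<d with a,c∈B, b,d∈C.)
NonCrossingRel : {m : ℕ} → (Fin m → Fin m → Set) → Set
NonCrossingRel {m} R =
  (a b c d : Fin m) → a F.< b → b F.< c → c F.< d → R a c → R b d → R a b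

IsNC : {m : ℕ} → Partition m → Set
IsNC α = NonCrossingRel (λ x y → α x ≡ α y)

sumF : {p : ℕ} → (Fin p → ℕ) → ℕ
sumF {zero} ks = 0
sumF {suc p} ks = ks zero + sumF (λ i → ks (suc i))

offset : {p : ℕ} → (Fin p → ℕ) → Fin p → ℕ
offset ks zero = 0
offset ks (suc i) = ks zero + offset (λ t → ks (suc t)) i

-- Embedding [k_i n] → [K n] (0-based):  a k_i + j ↦ a K + offset_i + j,
-- 0 ≤ a ≤ n-1, 0 ≤ j < k_i (the paper's 1-based j shifted by one).
-- Emb n ks i u x  means  "u is sent to x".
Emb : (n : ℕ) {p : ℕ} (ks : Fin p → ℕ) → Fin p → ℕ → ℕ → Set
Emb n ks i u x =
  ∃[ a ] ∃[ j ] (a < n × j < ks i × u ≡ a * ks i + j × x ≡ a * sumF ks + offset ks i + j)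

-- Block relation of the n-perfect shuffle α₁ ∗ₙ ⋯ ∗ₙ α_p on [K n]:
-- the union of the transported blocks of the αᵢ.
ShuffleRel : (n : ℕ) {p : ℕ} (ks : Fin p → ℕ)
  (αs : (i : Fin p) → Partition (ks i * n)) →
  Fin (sumF ks * n) → Fin (sumF ks * n) → Set
ShuffleRel n ks αs x y =
  Σ _ λ i → Σ (Fin (ks i * n)) λ u → Σ (Fin (ks i * n)) λ v →
    Emb n ks i (toℕ u) (toℕ x) × Emb n ks i (toℕ v) (toℕ y) × αs i u ≡ αs i v

ShuffleNC : (n : ℕ) {p : ℕ} (ks : Fin p → ℕ)
  (αs : (i : Fin p) → Partition (ks i * n)) → Set
ShuffleNC n ks αs = NonCrossingRel (ShuffleRel n ks αs)

pick2 : {p : ℕ} → Fin p → Fin p → Fin 2 → Fin p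
pick2 i j zero = i
pick2 i j (suc _) = j

PairShuffleNC : (n : ℕ) {p : ℕ} (ks : Fin p → ℕ)
  (αs : (i : Fin p) → Partition (ks i * n)) → Fin p → Fin p → Set
PairShuffleNC n ks αs i j =
  ShuffleNC n (λ t → ks (pick2 i j t)) (λ t → αs (pick2 i j t))

module Submission where

-- Positions of the shuffle are coded by (a , i , j) ↦ a K + offset i + j (round a, factor i,
-- place j < kᵢ), which is strictly increasing for the lexicographic order.  Hence the shuffle
-- of a subfamily (αᵢ)ᵢ∈σ sits order-preservingly inside the full shuffle with the same blocks,
-- so a crossing there is a crossing of the full shuffle: this gives (⇒).  Conversely, a
-- crossing a < b < c < d of the full shuffle with a, c coming from αᵢ and b, d from αᵢ′ is a
-- crossing of αᵢ if i = i′ and of αᵢ ∗ₙ αᵢ′ otherwise: this gives (⇐).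

open import Defs
open import Data.Nat using (ℕ; _*_)
open import Data.Fin using (Fin; _<_)
open import Data.Product using (_×_)

open import Data.Nat as ℕ using (suc; _+_; _≤_; z≤n; s≤s)
import Data.Nat.Properties as ℕₚ
open import Data.Fin using (toℕ; fromℕ<; zero; suc)
import Data.Fin.Properties as Finₚ
open import Data.Product as Prod using (Σ; ∃-syntax; _,_; proj₂)
open import Data.Product.Relation.Binary.Lex.Strict using (×-Lex; ×-compare)
open import Data.Product.Relation.Binary.Pointwise.NonDependent using (≡×≡⇒≡)
open import Data.Sum as Sum using (inj₁; inj₂; [_,_])
open import Data.Unit using (⊤; tt)
open import Data.Empty using (⊥-elim)
open import Function using (_∘_)
open import Function.Bundles using (_⇔_; mk⇔; Equivalence)
import Function.Properties.Equivalence as ⇔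
open import Relation.Binary.Core using (_Preserves_⟶_)
open import Relation.Binary.Definitions
  using (Trichotomous; Irreflexive; Asymmetric; tri<; tri≈; tri>)
open import Relation.Binary.PropositionalEquality using (_≡_; refl; sym; cong; subst₂)

module StrictlyMonotone
  {A B : Set} {_≈_ _<ᴬ_ : A → A → Set} {_<ᴮ_ : B → B → Set}
  (compare : Trichotomous _≈_ _<ᴬ_)
  (<ᴮ-irrefl : Irreflexive _≡_ _<ᴮ_) (<ᴮ-asym : Asymmetric _<ᴮ_)
  {P : A → Set} (f : A → B) (f-cong : ∀ {x y} → x ≈ y → f x ≡ f y)
  (f-mono : ∀ {x y} → P x → P y → x <ᴬ y → f x <ᴮ f y) where

  reflects : ∀ {x y} → P x → P y → f x <ᴮ f y → x <ᴬ y
  reflects {x} {y} px py fx<fy with compare x y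
  ... | tri< x<y _ _ = x<y
  ... | tri≈ _ x≈y _ = ⊥-elim (<ᴮ-irrefl (f-cong x≈y) fx<fy)
  ... | tri> _ _ y<x = ⊥-elim (<ᴮ-asym fx<fy (f-mono py px y<x))

  injective : ∀ {x y} → P x → P y → f x ≡ f y → x ≈ y
  injective {x} {y} px py fx≡fy with compare x y
  ... | tri< x<y _ _ = ⊥-elim (<ᴮ-irrefl fx≡fy (f-mono px py x<y))
  ... | tri≈ _ x≈y _ = x≈y
  ... | tri> _ _ y<x = ⊥-elim (<ᴮ-irrefl (sym fx≡fy) (f-mono py px y<x))

Lex₂ : ℕ × ℕ → ℕ × ℕ → Set
Lex₂ = ×-Lex _≡_ ℕ._<_ ℕ._<_

Lex₃ : ∀ {p} → ℕ × Fin p × ℕ → ℕ × Fin p × ℕ → Set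
Lex₃ = ×-Lex _≡_ ℕ._<_ (×-Lex _≡_ _<_ ℕ._<_)

radix : ℕ → ℕ × ℕ → ℕ
radix K (a , q) = a * K + q

radix-mono : ∀ {K} {x y : ℕ × ℕ} → proj₂ x ℕ.< K → proj₂ y ℕ.< K →
  Lex₂ x y → radix K x ℕ.< radix K y
radix-mono {K} {a , q} {a′ , q′} q<K _ (inj₁ a<a′) = begin-strict
  a * K + q   <⟨ ℕₚ.+-monoʳ-< (a * K) q<K ⟩
  a * K + K   ≡⟨ ℕₚ.+-comm (a * K) K ⟩
  suc a * K   ≤⟨ ℕₚ.*-monoˡ-≤ K a<a′ ⟩
  a′ * K      ≤⟨ ℕₚ.m≤m+n (a′ * K) q′ ⟩
  a′ * K + q′ ∎
  where open ℕₚ.≤-Reasoning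
radix-mono {K} {a , _} _ _ (inj₂ (refl , q<q′)) = ℕₚ.+-monoʳ-< (a * K) q<q′

module Radix (K : ℕ) =
  StrictlyMonotone (×-compare sym ℕₚ.<-cmp ℕₚ.<-cmp) ℕₚ.<-irrefl ℕₚ.<-asym
    (radix K) (cong (radix K) ∘ ≡×≡⇒≡) radix-mono

offset+size≤offset : ∀ {p} (ks : Fin p → ℕ) {i i′ : Fin p} → i < i′ →
  offset ks i + ks i ≤ offset ks i′
offset+size≤offset ks {zero} {suc _} _ = ℕₚ.m≤m+n (ks zero) _
offset+size≤offset ks {suc i} {suc i′} (s≤s i<i′) =
  ℕₚ.≤-trans (ℕₚ.≤-reflexive (ℕₚ.+-assoc (ks zero) _ _))
    (ℕₚ.+-monoʳ-≤ (ks zero) (offset+size≤offset (ks ∘ suc) i<i′))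

offset+size≤sumF : ∀ {p} (ks : Fin p → ℕ) (i : Fin p) → offset ks i + ks i ≤ sumF ks
offset+size≤sumF ks zero = ℕₚ.m≤m+n (ks zero) _
offset+size≤sumF ks (suc i) =
  ℕₚ.≤-trans (ℕₚ.≤-reflexive (ℕₚ.+-assoc (ks zero) _ _))
    (ℕₚ.+-monoʳ-≤ (ks zero) (offset+size≤sumF (ks ∘ suc) i))

offset+<sumF : ∀ {p} (ks : Fin p → ℕ) {i j} → j ℕ.< ks i → offset ks i + j ℕ.< sumF ks
offset+<sumF ks {i} j<k = ℕₚ.<-≤-trans (ℕₚ.+-monoʳ-< (offset ks i) j<k) (offset+size≤sumF ks i)

offset+-mono : ∀ {p} (ks : Fin p → ℕ) {i i′ j j′} → j ℕ.< ks i → j′ ℕ.< ks i′ →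
  ×-Lex _≡_ _<_ ℕ._<_ (i , j) (i′ , j′) → offset ks i + j ℕ.< offset ks i′ + j′
offset+-mono ks {i} {i′} {j} {j′} j<k _ (inj₁ i<i′) = begin-strict
  offset ks i + j    <⟨ ℕₚ.+-monoʳ-< (offset ks i) j<k ⟩
  offset ks i + ks i ≤⟨ offset+size≤offset ks i<i′ ⟩
  offset ks i′       ≤⟨ ℕₚ.m≤m+n (offset ks i′) j′ ⟩
  offset ks i′ + j′  ∎
  where open ℕₚ.≤-Reasoning
offset+-mono ks {i} _ _ (inj₂ (refl , j<j′)) = ℕₚ.+-monoʳ-< (offset ks i) j<j′

-- Emb n ks i u x says exactly that u = a kᵢ + j and x = code ks (a , i , j) with a < n, j < kᵢ.
code : ∀ {p} → (Fin p → ℕ) → ℕ × Fin p × ℕ → ℕ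
code ks (a , i , j) = a * sumF ks + offset ks i + j

InRange : ∀ {p} → (Fin p → ℕ) → ℕ × Fin p × ℕ → Set
InRange ks (_ , i , j) = j ℕ.< ks i

code-mono : ∀ {p} (ks : Fin p → ℕ) {x y} → InRange ks x → InRange ks y →
  Lex₃ x y → code ks x ℕ.< code ks y
code-mono ks {a , i , j} {a′ , i′ , j′} j<k j′<k x<y =
  subst₂ ℕ._<_ (sym (ℕₚ.+-assoc (a * sumF ks) _ j)) (sym (ℕₚ.+-assoc (a′ * sumF ks) _ j′))
    (radix-mono (offset+<sumF ks j<k) (offset+<sumF ks j′<k)
      (Sum.map₂ (Prod.map₂ (offset+-mono ks j<k j′<k)) x<y))

module Code {p} (ks : Fin p → ℕ) =
  StrictlyMonotone (×-compare sym ℕₚ.<-cmp (×-compare sym Finₚ.<-cmp ℕₚ.<-cmp))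
    ℕₚ.<-irrefl ℕₚ.<-asym
    (code ks) (cong (code ks) ∘ ≡×≡⇒≡ ∘ Prod.map₂ ≡×≡⇒≡) (code-mono ks)

code-<⇔ : ∀ {p} (ks : Fin p → ℕ) {x y} → InRange ks x → InRange ks y →
  code ks x ℕ.< code ks y ⇔ Lex₃ x y
code-<⇔ ks px py = mk⇔ (Code.reflects ks px py) (code-mono ks px py)

code<sumF*n : ∀ {n p} (ks : Fin p → ℕ) {a i j} → a ℕ.< n → j ℕ.< ks i →
  code ks (a , i , j) ℕ.< sumF ks * n
code<sumF*n {n} ks {a} {i} {j} a<n j<k = begin-strict
  a * sumF ks + offset ks i + j   ≡⟨ ℕₚ.+-assoc (a * sumF ks) _ j ⟩
  a * sumF ks + (offset ks i + j) <⟨ radix-mono q<K (ℕₚ.≤-<-trans z≤n q<K) (inj₁ a<n) ⟩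
  n * sumF ks + 0                 ≡⟨ ℕₚ.+-identityʳ _ ⟩
  n * sumF ks                     ≡⟨ ℕₚ.*-comm n (sumF ks) ⟩
  sumF ks * n                     ∎
  where
  open ℕₚ.≤-Reasoning
  q<K : offset ks i + j ℕ.< sumF ks
  q<K = offset+<sumF ks j<k

module _ {n p : ℕ} (ks : Fin p → ℕ) where

  Emb-at : ∀ {i a j} → a ℕ.< n → j ℕ.< ks i →
    Σ (Fin (sumF ks * n)) λ x → Emb n ks i (a * ks i + j) (toℕ x)
  Emb-at a<n j<k =
    fromℕ< (code<sumF*n ks a<n j<k) , _ , _ , a<n , j<k , refl , Finₚ.toℕ-fromℕ< _

  Emb-unique : ∀ {i i′ u u′ x} → Emb n ks i u x → Emb n ks i′ u′ x → i ≡ i′ × u ≡ u′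
  Emb-unique {i} {i′} (a , j , _ , j<k , refl , refl) (a′ , j′ , _ , j′<k , refl , x≡)
    with Code.injective ks {a , i , j} {a′ , i′ , j′} j<k j′<k x≡
  ... | refl , refl , refl = refl , refl

  Emb-source-< : ∀ {i u v x y} → Emb n ks i u x → Emb n ks i v y → x ℕ.< y → u ℕ.< v
  Emb-source-< {i} (a , j , _ , j<k , refl , refl) (b , l , _ , l<k , refl , refl) x<y =
    radix-mono j<k l<k (Sum.map₂ (Prod.map₂ [ ⊥-elim ∘ Finₚ.<-irrefl refl , proj₂ ])
      (Code.reflects ks {a , i , j} {b , i , l} j<k l<k x<y))

crossing-transfer : ∀ {m m′} {R : Fin m → Fin m → Set} {R′ : Fin m′ → Fin m′ → Set}
  (_∼_ : Fin m → Fin m′ → Set) →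
  (∀ {x y x′ y′} → x ∼ x′ → y ∼ y′ → x < y → x′ < y′) →
  (∀ {x y x′ y′} → x ∼ x′ → y ∼ y′ → R x y ⇔ R′ x′ y′) →
  NonCrossingRel R′ →
  ∀ {a b c d a′ b′ c′ d′} → a ∼ a′ → b ∼ b′ → c ∼ c′ → d ∼ d′ →
  a < b → b < c → c < d → R a c → R b d → R a b
crossing-transfer _∼_ <-pres R⇔R′ nc a∼ b∼ c∼ d∼ a<b b<c c<d ac bd =
  Equivalence.from (R⇔R′ a∼ b∼)
    (nc _ _ _ _ (<-pres a∼ b∼ a<b) (<-pres b∼ c∼ b<c) (<-pres c∼ d∼ c<d)
      (Equivalence.to (R⇔R′ a∼ c∼) ac) (Equivalence.to (R⇔R′ b∼ d∼) bd))

module Selection {n p q : ℕ} (ks : Fin p → ℕ) (αs : (i : Fin p) → Partition (ks i * n))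
  {σ : Fin q → Fin p} (σ-mono : σ Preserves _<_ ⟶ _<_) where

  private
    module σ = StrictlyMonotone Finₚ.<-cmp Finₚ.<-irrefl Finₚ.<-asym {P = λ _ → ⊤}
      σ (cong σ) (λ _ _ → σ-mono)

  Lex₃-σ⇔ : ∀ {a b t t′ j l} → Lex₃ (a , t , j) (b , t′ , l) ⇔ Lex₃ (a , σ t , j) (b , σ t′ , l)
  Lex₃-σ⇔ = mk⇔ (Sum.map₂ (Prod.map₂ (Sum.map σ-mono (Prod.map₁ (cong σ)))))
                (Sum.map₂ (Prod.map₂ (Sum.map (σ.reflects tt tt) (Prod.map₁ (σ.injective tt tt)))))

  Lift : ℕ → ℕ → Set
  Lift X x = ∃[ t ] ∃[ u ] (Emb n (ks ∘ σ) t u X × Emb n ks (σ t) u x)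

  Lift-<⇔ : ∀ {X Y x y} → Lift X x → Lift Y y → X ℕ.< Y ⇔ x ℕ.< y
  Lift-<⇔ (t , _ , (a , j , _ , j<k , refl , refl) , (a₁ , j₁ , _ , j₁<k , u≡ , refl))
          (t′ , _ , (b , l , _ , l<k , refl , refl) , (b₁ , l₁ , _ , l₁<k , v≡ , refl))
    with Radix.injective (ks (σ t)) {a , j} {a₁ , j₁} j<k j₁<k u≡
       | Radix.injective (ks (σ t′)) {b , l} {b₁ , l₁} l<k l₁<k v≡
  ... | refl , refl | refl , refl =
    ⇔.trans (code-<⇔ (ks ∘ σ) {a , t , j} {b , t′ , l} j<k l<k)
      (⇔.trans Lex₃-σ⇔ (⇔.sym (code-<⇔ ks {a , σ t , j} {b , σ t′ , l} j<k l<k)))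

  Lift-rel⁺ : ∀ {X Y x y} → Lift (toℕ X) (toℕ x) → Lift (toℕ Y) (toℕ y) →
    ShuffleRel n (ks ∘ σ) (αs ∘ σ) X Y → ShuffleRel n ks αs x y
  Lift-rel⁺ (t , _ , eX , ex) (t′ , _ , eY , ey) (s , u , v , eX′ , eY′ , α)
    with Emb-unique (ks ∘ σ) {s} {t} eX′ eX | Emb-unique (ks ∘ σ) {s} {t′} eY′ eY
  ... | refl , refl | refl , refl = _ , u , v , ex , ey , α

  Lift-rel⁻ : ∀ {X Y x y} → Lift (toℕ X) (toℕ x) → Lift (toℕ Y) (toℕ y) →
    ShuffleRel n ks αs x y → ShuffleRel n (ks ∘ σ) (αs ∘ σ) X Y
  Lift-rel⁻ (t , _ , eX , ex) (t′ , _ , eY , ey) (i , u , v , ex′ , ey′ , α)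
    with Emb-unique ks {i} {σ t} ex′ ex | Emb-unique ks {i} {σ t′} ey′ ey
  ... | refl , refl | σt≡σt′ , refl with σ.injective tt tt σt≡σt′
  ...   | refl = _ , u , v , eX , eY , α

  Lift-rel⇔ : ∀ {X Y x y} → Lift (toℕ X) (toℕ x) → Lift (toℕ Y) (toℕ y) →
    ShuffleRel n (ks ∘ σ) (αs ∘ σ) X Y ⇔ ShuffleRel n ks αs x y
  Lift-rel⇔ LX LY = mk⇔ (Lift-rel⁺ LX LY) (Lift-rel⁻ LX LY)

  Lift-up : ∀ {t u X} → Emb n (ks ∘ σ) t u X → Σ (Fin (sumF ks * n)) λ x → Lift X (toℕ x)
  Lift-up {t} eX@(_ , _ , a<n , j<k , refl , _) =
    Prod.map₂ (λ ex → _ , _ , eX , ex) (Emb-at ks {σ t} a<n j<k)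

  Lift-down : ∀ {t u x} → Emb n ks (σ t) u x → Σ (Fin (sumF (ks ∘ σ) * n)) λ X → Lift (toℕ X) x
  Lift-down {t} ex@(_ , _ , a<n , j<k , refl , _) =
    Prod.map₂ (λ eX → _ , _ , eX , ex) (Emb-at (ks ∘ σ) {t} a<n j<k)

  ShuffleNC-restrict : ShuffleNC n ks αs → ShuffleNC n (ks ∘ σ) (αs ∘ σ)
  ShuffleNC-restrict nc A B C D A<B B<C C<D
    AC@(_ , _ , _ , eA , eC , _) BD@(_ , _ , _ , eB , eD , _) =
    crossing-transfer (λ X x → Lift (toℕ X) (toℕ x))
      (λ LX LY → Equivalence.to (Lift-<⇔ LX LY)) Lift-rel⇔ nc
      (proj₂ (Lift-up eA)) (proj₂ (Lift-up eB)) (proj₂ (Lift-up eC)) (proj₂ (Lift-up eD))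
      A<B B<C C<D AC BD

  crossing-across : ShuffleNC n (ks ∘ σ) (αs ∘ σ) →
    ∀ {s s′ a b c d u u′ v v′} →
    Emb n ks (σ s) u (toℕ a) → Emb n ks (σ s′) u′ (toℕ b) →
    Emb n ks (σ s) v (toℕ c) → Emb n ks (σ s′) v′ (toℕ d) →
    a < b → b < c → c < d →
    ShuffleRel n ks αs a c → ShuffleRel n ks αs b d → ShuffleRel n ks αs a b
  crossing-across nc ea eb ec ed =
    crossing-transfer (λ x X → Lift (toℕ X) (toℕ x))
      (λ LX LY → Equivalence.from (Lift-<⇔ LX LY)) (λ LX LY → ⇔.sym (Lift-rel⇔ LX LY)) nc
      (proj₂ (Lift-down ea)) (proj₂ (Lift-down eb)) (proj₂ (Lift-down ec)) (proj₂ (Lift-down ed))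

pick2-mono : ∀ {p} {i j : Fin p} → i < j → pick2 i j Preserves _<_ ⟶ _<_
pick2-mono i<j {zero} {zero} ()
pick2-mono i<j {zero} {suc zero} _ = i<j
pick2-mono i<j {suc zero} {zero} ()
pick2-mono i<j {suc zero} {suc zero} (s≤s ())

module _ {n p : ℕ} (ks : Fin p → ℕ) (αs : (i : Fin p) → Partition (ks i * n)) {i : Fin p} where

  Emb-rel⁻ : ∀ {u v : Fin (ks i * n)} {x y} →
    Emb n ks i (toℕ u) (toℕ x) → Emb n ks i (toℕ v) (toℕ y) →
    ShuffleRel n ks αs x y → αs i u ≡ αs i v
  Emb-rel⁻ ex ey (i′ , _ , _ , ex′ , ey′ , α)
    with Emb-unique ks {i′} {i} ex′ ex | Emb-unique ks {i′} {i} ey′ ey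
  ... | refl , u≡ | _ , v≡ with Finₚ.toℕ-injective u≡ | Finₚ.toℕ-injective v≡
  ...   | refl | refl = α

  Emb-rel⇔ : ∀ {u v : Fin (ks i * n)} {x y} →
    Emb n ks i (toℕ u) (toℕ x) → Emb n ks i (toℕ v) (toℕ y) →
    ShuffleRel n ks αs x y ⇔ αs i u ≡ αs i v
  Emb-rel⇔ ex ey = mk⇔ (Emb-rel⁻ ex ey) (λ α → i , _ , _ , ex , ey , α)

  crossing-within : IsNC (αs i) →
    ∀ {a b c d} {u u′ v v′ : Fin (ks i * n)} →
    Emb n ks i (toℕ u) (toℕ a) → Emb n ks i (toℕ u′) (toℕ b) →
    Emb n ks i (toℕ v) (toℕ c) → Emb n ks i (toℕ v′) (toℕ d) →
    a < b → b < c → c < d →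
    ShuffleRel n ks αs a c → ShuffleRel n ks αs b d → ShuffleRel n ks αs a b
  crossing-within nc =
    crossing-transfer (λ x u → Emb n ks i (toℕ u) (toℕ x)) (Emb-source-< ks) Emb-rel⇔ nc

ShuffleNC-from-pairs : ∀ {n p} (ks : Fin p → ℕ) (αs : (i : Fin p) → Partition (ks i * n)) →
  (∀ i → IsNC (αs i)) → (∀ i j → i < j → PairShuffleNC n ks αs i j) → ShuffleNC n ks αs
ShuffleNC-from-pairs ks αs ncs pnc a b c d a<b b<c c<d
  ac@(i , _ , _ , ea , ec , _) bd@(i′ , _ , _ , eb , ed , _) with Finₚ.<-cmp i i′
... | tri< i<i′ _ _ = Selection.crossing-across ks αs (pick2-mono i<i′) (pnc i i′ i<i′)
  {s = zero} {s′ = suc zero} ea eb ec ed a<b b<c c<d ac bd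
... | tri≈ _ refl _ = crossing-within ks αs (ncs i) ea eb ec ed a<b b<c c<d ac bd
... | tri> _ _ i′<i = Selection.crossing-across ks αs (pick2-mono i′<i) (pnc i′ i i′<i)
  {s = suc zero} {s′ = zero} ea eb ec ed a<b b<c c<d ac bd

lemma3p10 : (n p : ℕ) (ks : Fin p → ℕ) (αs : (i : Fin p) → Partition (ks i * n)) →
    ((i : Fin p) → IsNC (αs i)) →
    (ShuffleNC n ks αs → ((i j : Fin p) → i < j → PairShuffleNC n ks αs i j))
    × (((i j : Fin p) → i < j → PairShuffleNC n ks αs i j) → ShuffleNC n ks αs)
lemma3p10 n p ks αs ncs =
  (λ nc i j i<j → Selection.ShuffleNC-restrict ks αs (pick2-mono i<j) nc) ,
  ShuffleNC-from-pairs ks αs ncs
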